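{- Let $B = M \cup \{\omega_1,\ldots,\omega_p\}$ be a basis, where $M$ is the set of all monotone Boolean functions, $p\ge 1$, and $\omega_1,\ldots,\omega_p$ are non-monotone Boolean functions. Then there exists a constant $c(B)$ (depending only on $B$) such that for every system $F=\{f_1(x_1,\ldots,x_n),\ldots,f_m(x_1,\ldots,x_n)\}$ of Boolean functions $$\left\lceil \log_2 (d(F)+1) \right\rceil - c(B) \le I_B(F) \le \left\lceil \log_2 (d(F)+1) \right\rceil .$$
   Context: Boolean functions are maps $E_2^n\to E_2$ with $E_2=\{0,1\}$; $P_2$ is the set of all Boolean functions. An increasing chain is a sequence of pairwise distinct tuples $\tilde\alpha_1,\ldots,\tilde\alpha_r\in E_2^n$ with $\tilde\alpha_i\le\tilde\alpha_{i+1}$ componentwise for $i=1,\ldots,r-1$. For a Boolean function $f$, an ordered pair $(\tilde\alpha,\tilde\beta)$ of tuples in $E_2^n$ is a jump of $f$ if $\tilde\alpha\le\tilde\beta$ componentwise and $f(\tilde\alpha)>f(\tilde\beta)$. For a system $F=\{f_1,\ldots,f_m\}$ of Boolean functions of $x_1,\ldots,x_n$, a pair is a jump for $F$ if it is a jump for some $f\in F$. For a chain $C=(\tilde\alpha_1,\ldots,\tilde\alpha_r)$, the decrease $d_C(F)$ is the number of indices $i\in\{1,\ldots,r-1\}$ such that $(\tilde\alpha_i,\tilde\alpha_{i+1})$ is a jump for $F$; the decrease $d(F)$ is the maximum of $d_C(F)$ over all increasing chains $C$ (for a single function $f$, $d(f)=d(\{f\})$). Circuits (Boolean circuits / circuits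 of functional elements) over $B$ have gates computing functions of $B$; gates computing functions from $M$ have weight $0$ and gates computing $\omega_1,\ldots,\omega_p$ have weight $1$. The inversion complexity $I_B(F)$ is the minimum, over all circuits over $B$ with inputs $x_1,\ldots,x_n$ realizing all functions of $F$ (at outputs), of the total weight, i.e. the number of gates computing functions from $\{\omega_1,\ldots,\omega_p\}$. -}

module Defs where

open import Data.Nat using (ℕ; zero; suc; _+_)
open import Data.Bool using (Bool; true; false; _≤_; _≤?_)
open import Data.Bool.Properties using (_≟_)
open import Data.Fin using (Fin)
open import Data.Fin.Properties using (any?)
open import Data.Vec using (Vec; lookup; map; _∷ʳ_)
open import Data.Vec.Relation.Binary.Pointwise.Inductive using (Pointwise) renaming (decidable to pw-dec)
open import Data.List using (List; []; _∷_)
open import Data.List.Relation.Unary.Unique.Propositional using (Unique)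
open import Data.List.Relation.Unary.Linked using (Linked)
open import Data.Product using (Σ; ∃; _×_; _,_)
open import Relation.Nullary using (¬_; Dec; does)
open import Relation.Nullary.Decidable using (_×-dec_)
open import Relation.Binary.PropositionalEquality using (_≡_)

BF : ℕ → Set
BF k = Vec Bool k → Bool

_≼_ : ∀ {k} → Vec Bool k → Vec Bool k → Set
_≼_ = Pointwise _≤_

Monotone : ∀ {k} → BF k → Set
Monotone {k} f = ∀ (α β : Vec Bool k) → α ≼ β → f α ≤ f β

-- A basis B = M ∪ {ω₁,…,ωₚ}, p ≥ 1, ωᵢ non-monotone (of arity arity i)
record Basis : Set where
  field
    p          : ℕ
    p≥1        : 1 Data.Nat.≤ p
    arity      : Fin p → ℕ
    ω          : (i : Fin p) → BF (arity i)
    ω-nonmono  : (i : Fin p) → ¬ Monotone (ω i)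

open Basis public

data Op (B : Basis) : ℕ → Set where
  mono    : ∀ {k} (f : BF k) → Monotone f → Op B k
  nonmono : (i : Fin (p B)) → Op B (arity B i)

opFun : ∀ {B k} → Op B k → BF k
opFun (mono f _)            = f
opFun {B} (nonmono i)       = ω B i

opWeight : ∀ {B k} → Op B k → ℕ
opWeight (mono _ _)  = 0
opWeight (nonmono _) = 1

record Gate (B : Basis) (N : ℕ) : Set where
  constructor gate
  field
    k    : ℕ
    op   : Op B k
    args : Vec (Fin N) k

-- Circuit B n N: circuit over B with inputs x₁…xₙ and N nodes in total
-- (the n inputs followed by the gates, in topological order)
data Circuit (B : Basis) (n : ℕ) : ℕ → Set where
  inputs : Circuit B n n
  _▷_    : ∀ {N} → Circuit B n N → Gate B N → Circuit B n (suc N)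

eval : ∀ {B n N} → Circuit B n N → Vec Bool n → Vec Bool N
eval inputs x = x
eval (C ▷ gate k op args) x =
  let v = eval C x in v ∷ʳ opFun op (map (lookup v) args)

weight : ∀ {B n N} → Circuit B n N → ℕ
weight inputs = 0
weight (C ▷ gate k op args) = opWeight op + weight C

Realizes : ∀ {B n N m} → Circuit B n N → Vec (BF n) m → Set
Realizes {n = n} {N} {m} C F =
  (j : Fin m) → Σ (Fin N) λ o → (x : Vec Bool n) → lookup (eval C x) o ≡ lookup F j x

IsInversionComplexity : (B : Basis) → ∀ {n m} → Vec (BF n) m → ℕ → Set
IsInversionComplexity B {n} F I =
  (Σ ℕ λ N → Σ (Circuit B n N) λ C → Realizes C F × weight C ≡ I)
  × (∀ N (C : Circuit B n N) → Realizes C F → I Data.Nat.≤ weight C)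

Jump : ∀ {n m} → Vec (BF n) m → Vec Bool n → Vec Bool n → Set
Jump {m = m} F α β =
  α ≼ β × ∃ λ (j : Fin m) → (lookup F j α ≡ true × lookup F j β ≡ false)

jump? : ∀ {n m} (F : Vec (BF n) m) α β → Dec (Jump F α β)
jump? F α β =
  pw-dec _≤?_ α β ×-dec any? (λ j → (lookup F j α ≟ true) ×-dec (lookup F j β ≟ false))

IncreasingChain : ∀ {n} → List (Vec Bool n) → Set
IncreasingChain C = Unique C × Linked _≼_ C

decreaseOn : ∀ {n m} → Vec (BF n) m → List (Vec Bool n) → ℕ
decreaseOn F (a ∷ b ∷ rest) =
  (if does (jump? F a b) then 1 else 0) + decreaseOn F (b ∷ rest)
  where open Data.Bool using (if_then_else_)
decreaseOn F _ = 0

IsDecrease : ∀ {n m} → Vec (BF n) m → ℕ → Set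
IsDecrease {n} F d =
  (Σ (List (Vec Bool n)) λ C → IncreasingChain C × decreaseOn F C ≡ d)
  × (∀ (C : List (Vec Bool n)) → IncreasingChain C → decreaseOn F C Data.Nat.≤ d)

-- Replace the outputs of the w ω-gates of a circuit by guesses
-- γ ∈ E₂ʷ; the resulting circuit is monotone in (x, γ).  Summing, over every
-- ω-gate and every guess for the earlier ω-gates, the number of true arguments
-- of the gate gives a potential that is monotone in x, bounded by A·2ʷ with A
-- exceeding all arities, and strictly increasing across every jump of F: a jump
-- forces some ω-value to change, and the first one that changes has strictly
-- more true arguments under the correct guess.  Hence d(F) < A·2ʷ.
--
-- Let μ x be d(F) minus the largest decrease of a chain
-- starting at x; μ is monotone, at most d(F), and increases across every jump.
-- Let s = ⌈log₂ (d(F) + 1)⌉ ω-gates compute the complemented binary digits of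
-- μ, most significant first: each digit is ω applied to a function monotone in
-- the inputs and the higher digits, and every output of F is monotone in the
-- inputs and the digits, so everything else is computed by monotone gates.
--
-- Since monotone gates are free, a circuit of weight w realizing F amounts to a
-- profile: a map G from the inputs to w ω-values, each of them ω applied to a
-- function monotone in the earlier values and the inputs, such that F is
-- monotone in (G x, x).  Profiles can be searched exhaustively, so the least
-- weight exists.

module Submission where

open import Defs
open import Data.Bool as Bool using (Bool; true; false; not; if_then_else_; f≤t; b≤b)
import Data.Bool.Properties as Boolₚ
open import Data.Empty using (⊥; ⊥-elim)
open import Data.Fin as Fin using (Fin)
import Data.Fin.Properties as Finₚ
open import Data.Nat
  using (ℕ; zero; suc; _+_; _*_; _∸_; _^_; _≤_; _<_; _<?_; z≤n; s≤s; _⊔_; ⌊_/2⌋; ⌈_/2⌉)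
open import Data.Nat.Induction using (Acc; acc; <-wellFounded)
open import Data.Nat.Logarithm using (⌈log₂_⌉; ⌈log₂⌉-mono-≤; ⌈log₂2^n⌉≡n)
open import Data.Nat.Logarithm.Core using (⌈log2⌉)
open import Data.Nat.Properties
open import Data.Product using (Σ; ∃; _×_; _,_; proj₁; proj₂)
open import Data.List using ([]; _∷_; length)
open import Data.List.Relation.Unary.Linked as Linked using (Linked; []; [-]; _∷_)
open import Data.List.Relation.Unary.Linked.Properties using (Linked⇒AllPairs)
import Data.List.Relation.Unary.AllPairs as AllPairs
open import Data.Unit using (⊤; tt)
open import Data.Sum using (_⊎_; inj₁; inj₂; [_,_]′)
open import Data.Vec as Vec using (Vec; []; _∷_; lookup; map; tabulate; _++_; _∷ʳ_)
import Data.Vec.Properties as Vecₚ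
open import Data.Vec.Relation.Binary.Pointwise.Inductive as Pointwise using ([]; _∷_)
open import Function using (id; _∘_; _on_)
open import Relation.Binary using (Reflexive; Transitive; _Preserves_⟶_)
open import Relation.Binary.PropositionalEquality
  using (module ≡-Reasoning; _≡_; _≢_; _≗_; refl; sym; trans; cong; cong₂; subst; subst₂)
open import Relation.Nullary using (¬_; Dec; yes; no; does; ¬?)
open import Relation.Nullary.Decidable
  using (map′; _⊎-dec_; _×-dec_; _→-dec_; decidable-stable; dec-true; dec-false)
open import Relation.Unary using (Pred; Decidable)

-- Exhaustive search

record Searchable (X : Set) : Set₁ where
  field
    ∃? : {P : Pred X _} → Decidable P → Dec (∃ P)

open Searchable public

module _ {X : Set} (S : Searchable X) where

  ∀? : {P : Pred X _} → Decidable P → Dec (∀ x → P x)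
  ∀? P? with ∃? S (¬? ∘ P?)
  ... | yes (x , ¬px) = no (λ all → ¬px (all x))
  ... | no ∄¬ = yes (λ x → decidable-stable (P? x) (λ ¬px → ∄¬ (x , ¬px)))

searchable-Bool : Searchable Bool
searchable-Bool .∃? {P} P? = map′ from to (P? false ⊎-dec P? true)
  where
  from : P false ⊎ P true → ∃ P
  from (inj₁ p) = false , p
  from (inj₂ p) = true , p
  to : ∃ P → P false ⊎ P true
  to (false , p) = inj₁ p
  to (true , p) = inj₂ p

searchable-× : {A B : Set} → Searchable A → Searchable B → Searchable (A × B)
searchable-× SA SB .∃? P? =
  map′ (λ (a , b , p) → (a , b) , p) (λ ((a , b) , p) → a , b , p)
       (∃? SA λ a → ∃? SB λ b → P? (a , b))

searchable-Vec : {A : Set} → Searchable A → ∀ k → Searchable (Vec A k)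
searchable-Vec S zero .∃? P? = map′ ([] ,_) (λ { ([] , p) → p }) (P? [])
searchable-Vec S (suc k) .∃? P? =
  map′ (λ (a , v , p) → a ∷ v , p) (λ { (a ∷ v , p) → a , v , p })
       (∃? S λ a → ∃? (searchable-Vec S k) λ v → P? (a ∷ v))

searchable-Fin : ∀ k → Searchable (Fin k)
searchable-Fin k .∃? = Finₚ.any?

searchable-Cube : ∀ k → Searchable (Vec Bool k)
searchable-Cube = searchable-Vec searchable-Bool

-- Functions on the cube are searched through their truth tables, which is
-- only complete for extensional predicates.
Table : ℕ → Set → Set
Table zero X = X
Table (suc n) X = Table n X × Table n X

searchable-Table : {X : Set} → Searchable X → ∀ n → Searchable (Table n X)
searchable-Table S zero = S
searchable-Table S (suc n) = searchable-× (searchable-Table S n) (searchable-Table S n)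

apply : ∀ {n} {X : Set} → Table n X → Vec Bool n → X
apply {zero} t [] = t
apply {suc n} (t₀ , t₁) (false ∷ v) = apply t₀ v
apply {suc n} (t₀ , t₁) (true ∷ v) = apply t₁ v

tabulateTable : ∀ {n} {X : Set} → (Vec Bool n → X) → Table n X
tabulateTable {zero} f = f []
tabulateTable {suc n} f = tabulateTable (f ∘ (false ∷_)) , tabulateTable (f ∘ (true ∷_))

apply-tabulateTable : ∀ {n} {X : Set} (f : Vec Bool n → X) → apply (tabulateTable f) ≗ f
apply-tabulateTable {zero} f [] = refl
apply-tabulateTable {suc n} f (false ∷ v) = apply-tabulateTable (f ∘ (false ∷_)) v
apply-tabulateTable {suc n} f (true ∷ v) = apply-tabulateTable (f ∘ (true ∷_)) v

Extensional : ∀ {n} {X : Set} → Pred (Vec Bool n → X) _ → Set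
Extensional P = ∀ {f g} → f ≗ g → P f → P g

∃-function? : ∀ {n} {X : Set} → Searchable X → {P : Pred (Vec Bool n → X) _} →
              Extensional P → Decidable P → Dec (∃ P)
∃-function? {n} S {P} resp P? =
  map′ (λ (t , p) → apply t , p)
       (λ (f , p) → tabulateTable f , resp (sym ∘ apply-tabulateTable f) p)
       (∃? (searchable-Table S n) (P? ∘ apply))

≼-refl : ∀ {k} → Reflexive (_≼_ {k})
≼-refl = Pointwise.refl Boolₚ.≤-refl

≼-trans : ∀ {k} → Transitive (_≼_ {k})
≼-trans = Pointwise.trans Boolₚ.≤-trans

_≼?_ : ∀ {k} (u v : Vec Bool k) → Dec (u ≼ v)
_≼?_ = Pointwise.decidable Bool._≤?_

true≰false : ∀ {a b} → a ≡ true → b ≡ false → ¬ (a Bool.≤ b)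
true≰false refl refl ()

≤-noDrop : ∀ a b → (a ≡ true → b ≡ false → ⊥) → a Bool.≤ b
≤-noDrop false b _ = Boolₚ.≤-minimum b
≤-noDrop true true _ = b≤b
≤-noDrop true false drop = ⊥-elim (drop refl refl)

bitValue : Bool → ℕ
bitValue b = if b then 1 else 0

countTrue : ∀ {k} → Vec Bool k → ℕ
countTrue [] = 0
countTrue (b ∷ v) = bitValue b + countTrue v

countTrue≤length : ∀ {k} (v : Vec Bool k) → countTrue v ≤ k
countTrue≤length [] = z≤n
countTrue≤length (false ∷ v) = m≤n⇒m≤1+n (countTrue≤length v)
countTrue≤length (true ∷ v) = s≤s (countTrue≤length v)

countTrue-mono : ∀ {k} → countTrue {k} Preserves _≼_ ⟶ _≤_
countTrue-mono [] = z≤n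
countTrue-mono (f≤t ∷ p) = m≤n⇒m≤1+n (countTrue-mono p)
countTrue-mono (b≤b {false} ∷ p) = countTrue-mono p
countTrue-mono (b≤b {true} ∷ p) = s≤s (countTrue-mono p)

countTrue-strict : ∀ {k} {u v : Vec Bool k} → u ≼ v → u ≢ v → countTrue u < countTrue v
countTrue-strict [] u≢v = ⊥-elim (u≢v refl)
countTrue-strict (f≤t ∷ p) _ = s≤s (countTrue-mono p)
countTrue-strict (b≤b {false} ∷ p) u≢v = countTrue-strict p (u≢v ∘ cong (false ∷_))
countTrue-strict (b≤b {true} ∷ p) u≢v = s≤s (countTrue-strict p (u≢v ∘ cong (true ∷_)))

≼-∷ʳ : ∀ {N} {u v : Vec Bool N} {a b} → u ≼ v → a Bool.≤ b → (u ∷ʳ a) ≼ (v ∷ʳ b)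
≼-∷ʳ [] a≤b = a≤b ∷ []
≼-∷ʳ (p ∷ ps) a≤b = p ∷ ≼-∷ʳ ps a≤b

lookups-mono : ∀ {N k} (is : Vec (Fin N) k) → (λ v → map (lookup v) is) Preserves _≼_ ⟶ _≼_
lookups-mono [] _ = []
lookups-mono (i ∷ is) u≼v = Pointwise.lookup u≼v i ∷ lookups-mono is u≼v

does-mono : {P Q : Set} → (P → Q) → (p? : Dec P) (q? : Dec Q) → does p? Bool.≤ does q?
does-mono _ _ (yes _) = Boolₚ.≤-maximum _
does-mono _ (no _) (no _) = b≤b
does-mono P⇒Q (yes p) (no ¬q) = ⊥-elim (¬q (P⇒Q p))

MonotoneOver : ∀ {n r k} → (Vec Bool n → Vec Bool r) → (Vec Bool n → Vec Bool k) → Set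
MonotoneOver H a = a Preserves (_≼_ on H) ⟶ _≼_

monotoneOver? : ∀ {n r k} (H : Vec Bool n → Vec Bool r) (a : Vec Bool n → Vec Bool k) →
                Dec (MonotoneOver H a)
monotoneOver? {n} H a = map′ (λ a-mono {x} {y} → a-mono x y) (λ a-mono x y → a-mono)
  (∀? (searchable-Cube n) λ x → ∀? (searchable-Cube n) λ y → (H x ≼? H y) →-dec (a x ≼? a y))

monotoneOver-≗ : ∀ {n r k} {H H′ : Vec Bool n → Vec Bool r} {a a′ : Vec Bool n → Vec Bool k} →
                 H ≗ H′ → a ≗ a′ → MonotoneOver H a → MonotoneOver H′ a′
monotoneOver-≗ {H = H} {H′} {a} {a′} H≗H′ a≗a′ a-mono {x} {y} =
  subst₂ _≼_ (a≗a′ x) (a≗a′ y) ∘ a-mono ∘ subst₂ _≼_ (sym (H≗H′ x)) (sym (H≗H′ y))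

-- A map that is monotone over H factors through H via a monotone map: its
-- coordinate j at z is the disjunction of the j-th coordinates of a x over all
-- x with H x ≼ z.
module _ {n r k} (H : Vec Bool n → Vec Bool r) (a : Vec Bool n → Vec Bool k)
         (a-mono : MonotoneOver H a) where

  private
    witness? : (j : Fin k) (z : Vec Bool r) → Dec (∃ λ x → H x ≼ z × lookup (a x) j ≡ true)
    witness? j z = ∃? (searchable-Cube n) λ x → (H x ≼? z) ×-dec (lookup (a x) j Boolₚ.≟ true)

  factorCoordinate : Fin k → BF r
  factorCoordinate j z = does (witness? j z)

  factorCoordinate-mono : ∀ j → Monotone (factorCoordinate j)
  factorCoordinate-mono j z z′ z≼z′ =
    does-mono (λ (x , Hx≼z , ax) → x , ≼-trans Hx≼z z≼z′ , ax) (witness? j z) (witness? j z′)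

  factorCoordinate-factors : ∀ j x → factorCoordinate j (H x) ≡ lookup (a x) j
  factorCoordinate-factors j x with lookup (a x) j in axj
  ... | true = dec-true (witness? j (H x)) (x , ≼-refl , axj)
  ... | false = dec-false (witness? j (H x)) λ (y , Hy≼Hx , ayj) →
    true≰false ayj axj (Pointwise.lookup (a-mono Hy≼Hx) j)

nonMonotone⇒negation : ∀ {k} (f : BF k) → ¬ Monotone f →
  Σ (Bool → Vec Bool k) λ s → s Preserves Bool._≤_ ⟶ _≼_ × (∀ b → f (s b) ≡ not b)
nonMonotone⇒negation {k} f ¬mono
  with ∃? (searchable-Cube k) (λ α → ∃? (searchable-Cube k) λ β →
         (α ≼? β) ×-dec (f α Boolₚ.≟ true) ×-dec (f β Boolₚ.≟ false))
... | yes (α , β , α≼β , fα , fβ) = s , s-mono , s-negates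
  where
  s : Bool → Vec Bool k
  s b = if b then β else α
  s-mono : s Preserves Bool._≤_ ⟶ _≼_
  s-mono f≤t = α≼β
  s-mono b≤b = ≼-refl
  s-negates : ∀ b → f (s b) ≡ not b
  s-negates false = fα
  s-negates true = fβ
... | no ∄jump = ⊥-elim (¬mono f-mono)
  where
  f-mono : Monotone f
  f-mono α β α≼β = ≤-noDrop (f α) (f β) λ fα fβ → ∄jump (α , β , α≼β , fα , fβ)

sumCube : ∀ w → (Vec Bool w → ℕ) → ℕ
sumCube zero f = f []
sumCube (suc w) f = sumCube w (f ∘ (false ∷_)) + sumCube w (f ∘ (true ∷_))

sumCube-mono : ∀ w {f g : Vec Bool w → ℕ} → (∀ γ → f γ ≤ g γ) → sumCube w f ≤ sumCube w g
sumCube-mono zero f≤g = f≤g []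
sumCube-mono (suc w) f≤g =
  +-mono-≤ (sumCube-mono w (f≤g ∘ (false ∷_))) (sumCube-mono w (f≤g ∘ (true ∷_)))

sumCube-strict : ∀ w {f g : Vec Bool w → ℕ} → (∀ γ → f γ ≤ g γ) →
                 ∀ γ → f γ < g γ → sumCube w f < sumCube w g
sumCube-strict zero f≤g [] f<g = f<g
sumCube-strict (suc w) f≤g (false ∷ γ) f<g =
  +-mono-<-≤ (sumCube-strict w (f≤g ∘ (false ∷_)) γ f<g) (sumCube-mono w (f≤g ∘ (true ∷_)))
sumCube-strict (suc w) f≤g (true ∷ γ) f<g =
  +-mono-≤-< (sumCube-mono w (f≤g ∘ (false ∷_))) (sumCube-strict w (f≤g ∘ (true ∷_)) γ f<g)

sumCube-bound : ∀ w {f : Vec Bool w → ℕ} k → (∀ γ → f γ ≤ k) → sumCube w f ≤ 2 ^ w * k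
sumCube-bound zero k f≤k = ≤-trans (f≤k []) (≤-reflexive (sym (+-identityʳ k)))
sumCube-bound (suc w) {f} k f≤k = begin
  sumCube (suc w) f         ≤⟨ +-mono-≤ (sumCube-bound w k (f≤k ∘ (false ∷_)))
                                        (sumCube-bound w k (f≤k ∘ (true ∷_))) ⟩
  2 ^ w * k + 2 ^ w * k     ≡⟨ cong (2 ^ w * k +_) (sym (+-identityʳ (2 ^ w * k))) ⟩
  2 * (2 ^ w * k)           ≡⟨ sym (*-assoc 2 (2 ^ w) k) ⟩
  2 ^ suc w * k             ∎
  where open ≤-Reasoning

maxCube : ∀ n → (Vec Bool n → ℕ) → ℕ
maxCube zero f = f []
maxCube (suc n) f = maxCube n (f ∘ (false ∷_)) ⊔ maxCube n (f ∘ (true ∷_))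

maxCube-upper : ∀ n (f : Vec Bool n → ℕ) x → f x ≤ maxCube n f
maxCube-upper zero f [] = ≤-refl
maxCube-upper (suc n) f (false ∷ x) = ≤-trans (maxCube-upper n (f ∘ (false ∷_)) x) (m≤m⊔n _ _)
maxCube-upper (suc n) f (true ∷ x) = ≤-trans (maxCube-upper n (f ∘ (true ∷_)) x) (m≤n⊔m _ _)

maxCube-attained : ∀ n (f : Vec Bool n → ℕ) → ∃ λ x → maxCube n f ≡ f x
maxCube-attained zero f = [] , refl
maxCube-attained (suc n) f
  with maxCube-attained n (f ∘ (false ∷_)) | maxCube-attained n (f ∘ (true ∷_))
     | ⊔-sel (maxCube n (f ∘ (false ∷_))) (maxCube n (f ∘ (true ∷_)))
... | x , max₀≡ | _ | inj₁ max≡max₀ = false ∷ x , trans max≡max₀ max₀≡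
... | _ | y , max₁≡ | inj₂ max≡max₁ = true ∷ y , trans max≡max₁ max₁≡

maxFin : ∀ p → (Fin p → ℕ) → ℕ
maxFin zero f = 0
maxFin (suc p) f = f Fin.zero ⊔ maxFin p (f ∘ Fin.suc)

maxFin-upper : ∀ p (f : Fin p → ℕ) i → f i ≤ maxFin p f
maxFin-upper (suc p) f Fin.zero = m≤m⊔n _ _
maxFin-upper (suc p) f (Fin.suc i) = ≤-trans (maxFin-upper p (f ∘ Fin.suc) i) (m≤n⊔m _ _)

n≤2^⌈log₂n⌉ : ∀ n → n ≤ 2 ^ ⌈log₂ n ⌉
n≤2^⌈log₂n⌉ n = go n (<-wellFounded n)
  where
  go : ∀ n (rec : Acc _<_ n) → n ≤ 2 ^ ⌈log2⌉ n rec
  go zero _ = z≤n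
  go (suc zero) _ = s≤s z≤n
  go (suc (suc n)) (acc rs) = begin
    2 + n                               ≤⟨ +-monoʳ-≤ 2 n≤2*⌈n/2⌉ ⟩
    2 + 2 * ⌈ n /2⌉                     ≡⟨ *-suc 2 ⌈ n /2⌉ ⟨
    2 * suc ⌈ n /2⌉                     ≤⟨ *-monoʳ-≤ 2 (go (suc ⌈ n /2⌉) (rs (⌈n/2⌉<n n))) ⟩
    2 * 2 ^ ⌈log2⌉ (suc ⌈ n /2⌉) _     ∎
    where
    open ≤-Reasoning
    n≤2*⌈n/2⌉ : n ≤ 2 * ⌈ n /2⌉
    n≤2*⌈n/2⌉ = begin
      n                         ≡⟨ ⌊n/2⌋+⌈n/2⌉≡n n ⟨
      ⌊ n /2⌋ + ⌈ n /2⌉         ≤⟨ +-monoˡ-≤ ⌈ n /2⌉ (⌊n/2⌋≤⌈n/2⌉ n) ⟩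
      ⌈ n /2⌉ + ⌈ n /2⌉         ≡⟨ cong (⌈ n /2⌉ +_) (+-identityʳ ⌈ n /2⌉) ⟨
      2 * ⌈ n /2⌉               ∎

-- The lower bound

indicator+≤ : {P : Set} {m k : ℕ} (p? : Dec P) → (P → m < k) → m ≤ k →
              bitValue (does p?) + m ≤ k
indicator+≤ (yes p) m<k _ = m<k p
indicator+≤ (no _) _ m≤k = m≤k

jumpIndicator : ∀ {n m} → Vec (BF n) m → Vec Bool n → Vec Bool n → ℕ
jumpIndicator F x y = bitValue (does (jump? F x y))

module _ {B : Basis} {n : ℕ} where

  -- latest ω-gate first
  omegaValues : ∀ {N} (C : Circuit B n N) → Vec Bool n → Vec Bool (weight C)
  omegaValues inputs x = []
  omegaValues (C ▷ gate k (mono f _) args) x = omegaValues C x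
  omegaValues (C ▷ gate k (nonmono i) args) x = ω B i (map (lookup (eval C x)) args) ∷ omegaValues C x

  evalWith : ∀ {N} (C : Circuit B n N) → Vec Bool n → Vec Bool (weight C) → Vec Bool N
  evalWith inputs x γ = x
  evalWith (C ▷ gate k (mono f _) args) x γ = let v = evalWith C x γ in v ∷ʳ f (map (lookup v) args)
  evalWith (C ▷ gate k (nonmono i) args) x (b ∷ γ) = evalWith C x γ ∷ʳ b

  eval≡evalWith : ∀ {N} (C : Circuit B n N) x → eval C x ≡ evalWith C x (omegaValues C x)
  eval≡evalWith inputs x = refl
  eval≡evalWith (C ▷ gate k (mono f _) args) x
    rewrite eval≡evalWith C x = refl
  eval≡evalWith (C ▷ gate k (nonmono i) args) x
    rewrite eval≡evalWith C x = refl

  evalWith-mono : ∀ {N} (C : Circuit B n N) {x y γ δ} → x ≼ y → γ ≼ δ →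
                  evalWith C x γ ≼ evalWith C y δ
  evalWith-mono inputs x≼y _ = x≼y
  evalWith-mono (C ▷ gate k (mono f f-mono) args) {x} {y} {γ} {δ} x≼y γ≼δ =
    ≼-∷ʳ v≼w (f-mono _ _ (lookups-mono args v≼w))
    where
    v≼w : evalWith C x γ ≼ evalWith C y δ
    v≼w = evalWith-mono C x≼y γ≼δ
  evalWith-mono (C ▷ gate k (nonmono i) args) x≼y (b≤c ∷ γ≼δ) =
    ≼-∷ʳ (evalWith-mono C x≼y γ≼δ) b≤c

  eval-mono : ∀ {N} (C : Circuit B n N) {x y} → x ≼ y → omegaValues C x ≼ omegaValues C y →
              eval C x ≼ eval C y
  eval-mono C {x} {y} x≼y ω≼ =
    subst₂ _≼_ (sym (eval≡evalWith C x)) (sym (eval≡evalWith C y)) (evalWith-mono C x≼y ω≼)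

  jump⇒omegaValues-differ : ∀ {m N} {F : Vec (BF n) m} (C : Circuit B n N) → Realizes C F →
                            ∀ {x y} → Jump F x y → omegaValues C x ≢ omegaValues C y
  jump⇒omegaValues-differ C R (x≼y , j , Fx , Fy) ωx≡ωy with R j
  ... | o , computes = true≰false (trans (computes _) Fx) (trans (computes _) Fy)
    (Pointwise.lookup (eval-mono C x≼y (subst (_ ≼_) ωx≡ωy ≼-refl)) o)

arityBound : Basis → ℕ
arityBound B = suc (maxFin (p B) (arity B))

module Potential {B : Basis} {n : ℕ} where

  private
    A : ℕ
    A = arityBound B

    argumentsWith : ∀ {N k} (C : Circuit B n N) →
                    Vec (Fin N) k → Vec Bool n → Vec Bool (weight C) → Vec Bool k
    argumentsWith C args x γ = map (lookup (evalWith C x γ)) args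

    argumentsWith-mono : ∀ {N k} (C : Circuit B n N) (args : Vec (Fin N) k) {x y} γ → x ≼ y →
                         argumentsWith C args x γ ≼ argumentsWith C args y γ
    argumentsWith-mono C args γ x≼y = lookups-mono args (evalWith-mono C x≼y ≼-refl)

  potential : ∀ {N} → Circuit B n N → Vec Bool n → ℕ
  potential inputs x = 0
  potential (C ▷ gate k (mono _ _) args) x = potential C x
  potential (C ▷ gate k (nonmono i) args) x =
    potential C x + sumCube (weight C) (countTrue ∘ argumentsWith C args x)

  potential-mono : ∀ {N} (C : Circuit B n N) → potential C Preserves _≼_ ⟶ _≤_
  potential-mono inputs _ = z≤n
  potential-mono (C ▷ gate k (mono _ _) args) x≼y = potential-mono C x≼y
  potential-mono (C ▷ gate k (nonmono i) args) x≼y =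
    +-mono-≤ (potential-mono C x≼y)
             (sumCube-mono (weight C) λ γ → countTrue-mono (argumentsWith-mono C args γ x≼y))

  potential-strict : ∀ {N} (C : Circuit B n N) {x y} → x ≼ y →
                     omegaValues C x ≢ omegaValues C y → potential C x < potential C y
  potential-strict inputs _ ω≢ = ⊥-elim (ω≢ refl)
  potential-strict (C ▷ gate k (mono _ _) args) x≼y ω≢ = potential-strict C x≼y ω≢
  potential-strict {suc N} (C ▷ gate k (nonmono i) args) {x} {y} x≼y ω≢
    with Vecₚ.≡-dec Boolₚ._≟_ (omegaValues C x) (omegaValues C y)
  ... | no ω≢′ = +-mono-<-≤ (potential-strict C x≼y ω≢′)
    (sumCube-mono (weight C) λ γ → countTrue-mono (argumentsWith-mono C args γ x≼y))
  ... | yes ω≡ = +-mono-≤-< (potential-mono C x≼y)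
    (sumCube-strict (weight C) (λ γ → countTrue-mono (argumentsWith-mono C args γ x≼y)) γ
      (countTrue-strict (argumentsWith-mono C args γ x≼y) arguments≢))
    where
    γ : Vec Bool (weight C)
    γ = omegaValues C x
    ωWith : Vec Bool n → Vec Bool (weight C) → Bool
    ωWith z δ = ω B i (argumentsWith C args z δ)
    arguments≢ : argumentsWith C args x γ ≢ argumentsWith C args y γ
    arguments≢ args≡ = ω≢ (cong₂ _∷_ (begin
      ω B i (map (lookup (eval C x)) args) ≡⟨ cong ωOf (eval≡evalWith C x) ⟩
      ωWith x γ                            ≡⟨ cong (ω B i) args≡ ⟩
      ωWith y γ                            ≡⟨ cong (ωWith y) ω≡ ⟩
      ωWith y (omegaValues C y)            ≡⟨ cong ωOf (eval≡evalWith C y) ⟨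
      ω B i (map (lookup (eval C y)) args) ∎) ω≡)
      where
      open ≡-Reasoning
      ωOf : Vec Bool N → Bool
      ωOf v = ω B i (map (lookup v) args)

  potential-bound : ∀ {N} (C : Circuit B n N) x → potential C x + A ≤ A * 2 ^ weight C
  potential-bound inputs x = ≤-reflexive (sym (*-identityʳ A))
  potential-bound (C ▷ gate k (mono _ _) args) x = potential-bound C x
  potential-bound (C ▷ gate k (nonmono i) args) x = begin
    potential C x + S + A      ≡⟨ +-assoc (potential C x) S A ⟩
    potential C x + (S + A)    ≡⟨ cong (potential C x +_) (+-comm S A) ⟩
    potential C x + (A + S)    ≡⟨ +-assoc (potential C x) A S ⟨
    potential C x + A + S      ≤⟨ +-mono-≤ (potential-bound C x) (sumCube-bound w A countTrue≤A) ⟩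
    A * 2 ^ w + 2 ^ w * A      ≡⟨ cong (A * 2 ^ w +_) (*-comm (2 ^ w) A) ⟩
    A * 2 ^ w + A * 2 ^ w      ≡⟨ *-distribˡ-+ A (2 ^ w) (2 ^ w) ⟨
    A * (2 ^ w + 2 ^ w)        ≡⟨ cong (λ z → A * (2 ^ w + z)) (+-identityʳ (2 ^ w)) ⟨
    A * 2 ^ suc w              ∎
    where
    open ≤-Reasoning
    w : ℕ
    w = weight C
    S : ℕ
    S = sumCube w (countTrue ∘ argumentsWith C args x)
    countTrue≤A : ∀ γ → countTrue (argumentsWith C args x γ) ≤ A
    countTrue≤A γ = ≤-trans (countTrue≤length (argumentsWith C args x γ))
                            (m≤n⇒m≤1+n (maxFin-upper (p B) (arity B) i))

  module _ {m N} {F : Vec (BF n) m} (C : Circuit B n N) (R : Realizes C F) where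

    decreaseOn+potential≤ : ∀ x ys → Linked _≼_ (x ∷ ys) →
                            decreaseOn F (x ∷ ys) + potential C x + A ≤ A * 2 ^ weight C
    decreaseOn+potential≤ x [] [-] = potential-bound C x
    decreaseOn+potential≤ x (y ∷ ys) (x≼y ∷ linked) = begin
      jumpIndicator F x y + D + potential C x + A    ≡⟨ cong (_+ A) rearrange ⟩
      D + (jumpIndicator F x y + potential C x) + A  ≤⟨ +-monoˡ-≤ A (+-monoʳ-≤ D step) ⟩
      D + potential C y + A                          ≤⟨ decreaseOn+potential≤ y ys linked ⟩
      A * 2 ^ weight C                               ∎
      where
      open ≤-Reasoning
      D : ℕ
      D = decreaseOn F (y ∷ ys)
      rearrange : jumpIndicator F x y + D + potential C x ≡ D + (jumpIndicator F x y + potential C x)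
      rearrange = trans (cong (_+ potential C x) (+-comm (jumpIndicator F x y) D))
                        (+-assoc D (jumpIndicator F x y) (potential C x))
      step : jumpIndicator F x y + potential C x ≤ potential C y
      step = indicator+≤ (jump? F x y)
        (potential-strict C x≼y ∘ jump⇒omegaValues-differ {F = F} C R) (potential-mono C x≼y)

    decreaseOn-bound : ∀ {cs} → Linked _≼_ cs → decreaseOn F cs + A ≤ A * 2 ^ weight C
    decreaseOn-bound [] = ≤-trans (≤-reflexive (sym (*-identityʳ A))) (*-monoʳ-≤ A (m^n>0 2 (weight C)))
    decreaseOn-bound {x ∷ ys} linked =
      ≤-trans (+-monoˡ-≤ A (m≤m+n _ (potential C x))) (decreaseOn+potential≤ x ys linked)

    lowerBound : ∀ {d} → IsDecrease F d → ⌈log₂ (d + 1) ⌉ ≤ weight C + ⌈log₂ A ⌉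
    lowerBound {d} ((cs , (_ , linked) , refl) , _) = begin
      ⌈log₂ (d + 1) ⌉            ≤⟨ ⌈log₂⌉-mono-≤ d+1≤ ⟩
      ⌈log₂ (2 ^ (w + c)) ⌉      ≡⟨ ⌈log₂2^n⌉≡n (w + c) ⟩
      w + c                      ∎
      where
      open ≤-Reasoning
      w c : ℕ
      w = weight C
      c = ⌈log₂ A ⌉
      d+1≤ : d + 1 ≤ 2 ^ (w + c)
      d+1≤ = begin
        d + 1          ≤⟨ +-monoʳ-≤ d (s≤s z≤n) ⟩
        d + A          ≤⟨ decreaseOn-bound linked ⟩
        A * 2 ^ w      ≤⟨ *-monoˡ-≤ (2 ^ w) (n≤2^⌈log₂n⌉ A) ⟩
        2 ^ c * 2 ^ w  ≡⟨ *-comm (2 ^ c) (2 ^ w) ⟩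
        2 ^ w * 2 ^ c  ≡⟨ ^-distribˡ-+-* 2 w c ⟨
        2 ^ (w + c)    ∎

-- A rank increasing across jumps

record JumpRank {n m} (F : Vec (BF n) m) (d : ℕ) : Set where
  field
    rank       : Vec Bool n → ℕ
    rank-mono  : rank Preserves _≼_ ⟶ _≤_
    rank-jump  : ∀ {x y} → Jump F x y → rank x < rank y
    rank-bound : ∀ x → rank x ≤ d

module Climb {n m : ℕ} (F : Vec (BF n) m) where

  _≺_ : Vec Bool n → Vec Bool n → Set
  u ≺ v = u ≼ v × countTrue u < countTrue v

  _≺?_ : ∀ u v → Dec (u ≺ v)
  u ≺? v = (u ≼? v) ×-dec (countTrue u <? countTrue v)

  ≺-trans : Transitive _≺_
  ≺-trans (u≼v , u<v) (v≼w , v<w) = ≼-trans u≼v v≼w , <-trans u<v v<w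

  -- climb f x is the largest decrease along a ≺-chain of at most f steps from
  -- x, and climbVia f x y the same with first step to y
  climb : ℕ → Vec Bool n → ℕ
  climbVia : ℕ → Vec Bool n → Vec Bool n → ℕ

  climb zero x = 0
  climb (suc f) x = maxCube n (climbVia f x)

  climbVia f x y = if does (x ≺? y) then jumpIndicator F x y + climb f y else 0

  climb-≺ : ∀ f {x y} → x ≺ y → jumpIndicator F x y + climb f y ≤ climb (suc f) x
  climb-≺ f {x} {y} x≺y = begin
    jumpIndicator F x y + climb f y ≡⟨ cong (λ b → if b then jumpIndicator F x y + climb f y else 0)
                                            (dec-true (x ≺? y) x≺y) ⟨
    climbVia f x y                  ≤⟨ maxCube-upper n (climbVia f x) y ⟩
    climb (suc f) x                 ∎
    where open ≤-Reasoning

  decreaseOn≤climb : ∀ f x ys → Linked _≺_ (x ∷ ys) → length ys ≤ f →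
                     decreaseOn F (x ∷ ys) ≤ climb f x
  decreaseOn≤climb f x [] _ _ = z≤n
  decreaseOn≤climb (suc f) x (y ∷ ys) (x≺y ∷ linked) (s≤s length≤f) =
    ≤-trans (+-monoʳ-≤ (jumpIndicator F x y) (decreaseOn≤climb f y ys linked length≤f))
            (climb-≺ f x≺y)

  climb-attained : ∀ f x → ∃ λ ys → Linked _≺_ (x ∷ ys) × decreaseOn F (x ∷ ys) ≡ climb f x
  climb-attained zero x = [] , [-] , refl
  climb-attained (suc f) x with maxCube-attained n (climbVia f x)
  ... | y , climb≡ = extend (x ≺? y) climb≡
    where
    extend : (x≺?y : Dec (x ≺ y)) →
             climb (suc f) x ≡ (if does x≺?y then jumpIndicator F x y + climb f y else 0) →
             ∃ λ ys → Linked _≺_ (x ∷ ys) × decreaseOn F (x ∷ ys) ≡ climb (suc f) x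
    extend (no _) climb≡ = [] , [-] , sym climb≡
    extend (yes x≺y) climb≡ with climb-attained f y
    ... | ys , linked , decrease≡ =
      y ∷ ys , x≺y ∷ linked , trans (cong (jumpIndicator F x y +_) decrease≡) (sym climb≡)

  ≺-chain-length : ∀ x ys → Linked _≺_ (x ∷ ys) → length ys + countTrue x ≤ n
  ≺-chain-length x [] _ = countTrue≤length x
  ≺-chain-length x (y ∷ ys) ((_ , x<y) ∷ linked) = begin
    suc (length ys) + countTrue x   ≡⟨ +-suc (length ys) (countTrue x) ⟨
    length ys + suc (countTrue x)   ≤⟨ +-monoʳ-≤ (length ys) x<y ⟩
    length ys + countTrue y         ≤⟨ ≺-chain-length y ys linked ⟩
    n                               ∎
    where open ≤-Reasoning

  ≺-chain⇒increasing : ∀ {cs} → Linked _≺_ cs → IncreasingChain cs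
  ≺-chain⇒increasing linked =
    AllPairs.map (λ (_ , u<v) u≡v → <-irrefl (cong countTrue u≡v) u<v)
                 (Linked⇒AllPairs ≺-trans linked) ,
    Linked.map proj₁ linked

  climb≤climb-n : ∀ f x → climb f x ≤ climb n x
  climb≤climb-n f x with climb-attained f x
  ... | ys , linked , decrease≡ = subst (_≤ climb n x) decrease≡
    (decreaseOn≤climb n x ys linked (≤-trans (m≤m+n _ _) (≺-chain-length x ys linked)))

  climb-step : ∀ {x y} → x ≼ y → jumpIndicator F x y + climb n y ≤ climb n x
  climb-step {x} {y} x≼y with Vecₚ.≡-dec Boolₚ._≟_ x y
  ... | yes refl = ≤-reflexive (cong (λ b → bitValue b + climb n x) (dec-false (jump? F x x) no-self-jump))
    where
    no-self-jump : ¬ Jump F x x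
    no-self-jump (_ , j , Fx , Fx′) = true≰false Fx Fx′ Boolₚ.≤-refl
  ... | no x≢y = ≤-trans (climb-≺ n (x≼y , countTrue-strict x≼y x≢y)) (climb≤climb-n (suc n) x)

  module _ {d : ℕ} (isDecrease : IsDecrease F d) where

    climb≤d : ∀ f x → climb f x ≤ d
    climb≤d f x with climb-attained f x
    ... | ys , linked , decrease≡ =
      subst (_≤ d) decrease≡ (proj₂ isDecrease (x ∷ ys) (≺-chain⇒increasing linked))

    jumpRank : JumpRank F d
    jumpRank = record
      { rank = λ x → d ∸ climb n x
      ; rank-mono = λ {x} {y} x≼y →
          ∸-monoʳ-≤ d (≤-trans (m≤n+m (climb n y) (jumpIndicator F x y)) (climb-step x≼y))
      ; rank-jump = λ {x} {y} jump → ∸-monoʳ-< (climb-jump jump) (climb≤d n x)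
      ; rank-bound = λ x → m∸n≤m d (climb n x)
      }
      where
      climb-jump : ∀ {x y} → Jump F x y → climb n y < climb n x
      climb-jump {x} {y} jump = subst (λ b → bitValue b + climb n y ≤ climb n x)
                                      (dec-true (jump? F x y) jump) (climb-step (proj₁ jump))

lookup-∷ʳ-inject₁ : ∀ {A : Set} {N} (v : Vec A N) a i →
                    lookup (v ∷ʳ a) (Fin.inject₁ i) ≡ lookup v i
lookup-∷ʳ-inject₁ (_ ∷ v) a Fin.zero = refl
lookup-∷ʳ-inject₁ (_ ∷ v) a (Fin.suc i) = lookup-∷ʳ-inject₁ v a i

lookup-∷ʳ-last : ∀ {A : Set} {N} (v : Vec A N) a → lookup (v ∷ʳ a) (Fin.fromℕ N) ≡ a
lookup-∷ʳ-last [] a = refl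
lookup-∷ʳ-last (_ ∷ v) a = lookup-∷ʳ-last v a

module Build {B : Basis} {n : ℕ} where

  record Computes {N} (C : Circuit B n N) (h : BF n) : Set where
    constructor node
    field
      index   : Fin N
      correct : ∀ x → lookup (eval C x) index ≡ h x

  open Computes public

  record ComputesAll {N r} (C : Circuit B n N) (H : Vec Bool n → Vec Bool r) : Set where
    constructor computesAll
    field
      computes : ∀ j → Computes C (λ x → lookup (H x) j)

  open ComputesAll public

  computes-≗ : ∀ {N} {C : Circuit B n N} {h h′} → h ≗ h′ → Computes C h → Computes C h′
  computes-≗ h≗h′ (node o correct) = node o λ x → trans (correct x) (h≗h′ x)

  computesAll-≗ : ∀ {N r} {C : Circuit B n N} {H H′ : Vec Bool n → Vec Bool r} →
                  H ≗ H′ → ComputesAll C H → ComputesAll C H′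
  computesAll-≗ H≗H′ c =
    computesAll λ j → computes-≗ (λ x → cong (λ v → lookup v j) (H≗H′ x)) (computes c j)

  computesAll-∷ : ∀ {N r} {C : Circuit B n N} {h} {H : Vec Bool n → Vec Bool r} →
                  Computes C h → ComputesAll C H → ComputesAll C (λ x → h x ∷ H x)
  computesAll-∷ c cs = computesAll λ where
    Fin.zero → c
    (Fin.suc j) → computes cs j

  computesAll-inputs : ComputesAll inputs (λ x → x)
  computesAll-inputs = computesAll λ j → node j λ x → refl

  computes-▷ : ∀ {N} {C : Circuit B n N} {h} (g : Gate B N) → Computes C h → Computes (C ▷ g) h
  computes-▷ {C = C} (gate k op args) (node o correct) =
    node (Fin.inject₁ o) λ x → trans (lookup-∷ʳ-inject₁ (eval C x) _ o) (correct x)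

  computesAll-▷ : ∀ {N r} {C : Circuit B n N} {H : Vec Bool n → Vec Bool r} (g : Gate B N) →
                  ComputesAll C H → ComputesAll (C ▷ g) H
  computesAll-▷ g c = computesAll (computes-▷ g ∘ computes c)

  nodes : ∀ {N r} {C : Circuit B n N} {H : Vec Bool n → Vec Bool r} → ComputesAll C H → Vec (Fin N) r
  nodes c = tabulate (index ∘ computes c)

  nodes-values : ∀ {N r} {C : Circuit B n N} {H : Vec Bool n → Vec Bool r} (c : ComputesAll C H) x →
                 map (lookup (eval C x)) (nodes c) ≡ H x
  nodes-values {C = C} {H} c x = begin
    map (lookup (eval C x)) (tabulate (index ∘ computes c))
      ≡⟨ Vecₚ.tabulate-∘ (lookup (eval C x)) (index ∘ computes c) ⟨
    tabulate (λ j → lookup (eval C x) (index (computes c j)))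
      ≡⟨ Vecₚ.tabulate-cong (λ j → correct (computes c j) x) ⟩
    tabulate (lookup (H x))
      ≡⟨ Vecₚ.tabulate∘lookup (H x) ⟩
    H x ∎
    where open ≡-Reasoning

  gate-computes : ∀ {N r} {C : Circuit B n N} {H : Vec Bool n → Vec Bool r}
                  (c : ComputesAll C H) (op : Op B r) →
                  Computes (C ▷ gate r op (nodes c)) (λ x → opFun op (H x))
  gate-computes {N} {C = C} c op =
    node (Fin.fromℕ N) λ x → trans (lookup-∷ʳ-last (eval C x) _) (cong (opFun op) (nodes-values c x))

  addMonotoneGates : ∀ {N r k} (C : Circuit B n N) {H : Vec Bool n → Vec Bool r} → ComputesAll C H →
    (fs : Fin k → BF r) → (∀ j → Monotone (fs j)) →
    ∃ λ N′ → Σ (Circuit B n N′) λ C′ →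
      weight C′ ≡ weight C × ComputesAll C′ H × ComputesAll C′ (λ x → tabulate λ j → fs j (H x))
  addMonotoneGates {k = zero} C c fs fs-mono = _ , C , refl , c , computesAll λ ()
  addMonotoneGates {r = r} {k = suc k} C c fs fs-mono
    with addMonotoneGates C c (fs ∘ Fin.suc) (fs-mono ∘ Fin.suc)
  ... | N₁ , C₁ , weight≡ , c₁ , cfs = _ , C₁ ▷ g , weight≡ , computesAll-▷ g c₁ ,
        computesAll-∷ (gate-computes c₁ op) (computesAll-▷ g cfs)
    where
    op : Op B r
    op = mono (fs Fin.zero) (fs-mono Fin.zero)
    g : Gate B N₁
    g = gate r op (nodes c₁)

  addMonotoneOver : ∀ {N r k} (C : Circuit B n N) {H : Vec Bool n → Vec Bool r}
    {a : Vec Bool n → Vec Bool k} → ComputesAll C H → MonotoneOver H a →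
    ∃ λ N′ → Σ (Circuit B n N′) λ C′ →
      weight C′ ≡ weight C × ComputesAll C′ H × ComputesAll C′ a
  addMonotoneOver C {H} {a} c a-mono
    with addMonotoneGates C c (factorCoordinate H a a-mono) (factorCoordinate-mono H a a-mono)
  ... | _ , C′ , weight≡ , c′ , cfs = _ , C′ , weight≡ , c′ , computesAll-≗ factors cfs
    where
    factors : (λ x → tabulate λ j → factorCoordinate H a a-mono j (H x)) ≗ a
    factors x = trans (Vecₚ.tabulate-cong λ j → factorCoordinate-factors H a a-mono j x)
                      (Vecₚ.tabulate∘lookup (a x))

-- Profiles

head∷tail : ∀ {A : Set} {w} (v : Vec A (suc w)) → Vec.head v ∷ Vec.tail v ≡ v
head∷tail (_ ∷ _) = refl

empty≡[] : ∀ {A : Set} (v : Vec A 0) → v ≡ []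
empty≡[] [] = refl

module Profiles (B : Basis) {n m : ℕ} (F : Vec (BF n) m) where
  open Build {B} {n}

  withInputs : ∀ {w} → (Vec Bool n → Vec Bool w) → Vec Bool n → Vec Bool (w + n)
  withInputs G x = G x ++ x

  outputs : Vec Bool n → Vec Bool m
  outputs x = tabulate λ j → lookup F j x

  OmegaStep : ∀ {w} → (Vec Bool n → Bool) → (Vec Bool n → Vec Bool w) → Set
  OmegaStep g G = Σ (Fin (p B)) λ i → Σ (Vec Bool n → Vec Bool (arity B i)) λ a →
    ω B i ∘ a ≗ g × MonotoneOver (withInputs G) a

  -- G x plays the role of omegaValues C x: latest ω-gate first.
  OmegaSequence : ∀ {w} → (Vec Bool n → Vec Bool w) → Set
  OmegaSequence {zero} G = ⊤
  OmegaSequence {suc w} G = OmegaSequence (Vec.tail ∘ G) × OmegaStep (Vec.head ∘ G) (Vec.tail ∘ G)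

  Profile : ℕ → Set
  Profile w = Σ (Vec Bool n → Vec Bool w) λ G → OmegaSequence G × MonotoneOver (withInputs G) outputs

  withInputs-≗ : ∀ {w} {G G′ : Vec Bool n → Vec Bool w} → G ≗ G′ → withInputs G ≗ withInputs G′
  withInputs-≗ G≗G′ x = cong (_++ x) (G≗G′ x)

  omegaStep-≗ : ∀ {w} {g g′} {G G′ : Vec Bool n → Vec Bool w} →
                g ≗ g′ → G ≗ G′ → OmegaStep g G → OmegaStep g′ G′
  omegaStep-≗ g≗g′ G≗G′ (i , a , ωa≗g , a-mono) =
    i , a , (λ x → trans (ωa≗g x) (g≗g′ x)) ,
    monotoneOver-≗ (withInputs-≗ G≗G′) (λ _ → refl) a-mono

  omegaSequence-≗ : ∀ {w} {G G′ : Vec Bool n → Vec Bool w} →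
                    G ≗ G′ → OmegaSequence G → OmegaSequence G′
  omegaSequence-≗ {zero} _ _ = tt
  omegaSequence-≗ {suc w} G≗G′ (sequence , step) =
    omegaSequence-≗ (cong Vec.tail ∘ G≗G′) sequence ,
    omegaStep-≗ (cong Vec.head ∘ G≗G′) (cong Vec.tail ∘ G≗G′) step

  omegaStep? : ∀ {w} g (G : Vec Bool n → Vec Bool w) → Dec (OmegaStep g G)
  omegaStep? g G = ∃? (searchable-Fin (p B)) λ i →
    ∃-function? (searchable-Cube (arity B i)) (respects i) λ a →
      ∀? (searchable-Cube n) (λ x → ω B i (a x) Boolₚ.≟ g x) ×-dec monotoneOver? (withInputs G) a
    where
    respects : ∀ i → Extensional (λ a → ω B i ∘ a ≗ g × MonotoneOver (withInputs G) a)
    respects i a≗a′ (ωa≗g , a-mono) =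
      (λ x → trans (cong (ω B i) (sym (a≗a′ x))) (ωa≗g x)) ,
      monotoneOver-≗ (λ _ → refl) a≗a′ a-mono

  omegaSequence? : ∀ {w} (G : Vec Bool n → Vec Bool w) → Dec (OmegaSequence G)
  omegaSequence? {zero} G = yes tt
  omegaSequence? {suc w} G = omegaSequence? (Vec.tail ∘ G) ×-dec omegaStep? (Vec.head ∘ G) (Vec.tail ∘ G)

  profile? : ∀ w → Dec (Profile w)
  profile? w = ∃-function? (searchable-Cube w) respects λ G →
    omegaSequence? G ×-dec monotoneOver? (withInputs G) outputs
    where
    respects : Extensional (λ G → OmegaSequence G × MonotoneOver (withInputs G) outputs)
    respects G≗G′ (sequence , outputs-mono) =
      omegaSequence-≗ G≗G′ sequence ,
      monotoneOver-≗ (withInputs-≗ G≗G′) (λ _ → refl) outputs-mono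

  eval-monotoneOver : ∀ {N} (C : Circuit B n N) → MonotoneOver (withInputs (omegaValues C)) (eval C)
  eval-monotoneOver C {x} {y} ω++x≼ω++y =
    let ω≼ , x≼y = Pointwise.++⁻ (omegaValues C x) (omegaValues C y) ω++x≼ω++y
    in eval-mono C x≼y ω≼

  omegaValues-sequence : ∀ {N} (C : Circuit B n N) → OmegaSequence (omegaValues C)
  omegaValues-sequence inputs = tt
  omegaValues-sequence (C ▷ gate k (mono _ _) args) = omegaValues-sequence C
  omegaValues-sequence (C ▷ gate k (nonmono i) args) =
    omegaValues-sequence C , i , (λ x → map (lookup (eval C x)) args) , (λ x → refl) ,
    lookups-mono args ∘ eval-monotoneOver C

  circuit⇒profile : ∀ {N} (C : Circuit B n N) → Realizes C F → Profile (weight C)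
  circuit⇒profile C R = omegaValues C , omegaValues-sequence C , outputs-mono
    where
    outputs-mono : MonotoneOver (withInputs (omegaValues C)) outputs
    outputs-mono {x} {y} le = Pointwise.tabulate⁺ λ j →
      let o , computes = R j in
      subst₂ Bool._≤_ (computes x) (computes y) (Pointwise.lookup (eval-monotoneOver C le) o)

  buildOmegaSequence : ∀ {w} (G : Vec Bool n → Vec Bool w) → OmegaSequence G →
    ∃ λ N → Σ (Circuit B n N) λ C → weight C ≡ w × ComputesAll C (withInputs G)
  buildOmegaSequence {zero} G _ =
    n , inputs , refl , computesAll-≗ (λ x → cong (_++ x) (sym (empty≡[] (G x)))) computesAll-inputs
  buildOmegaSequence {suc w} G (sequence , i , a , ωa≗g , a-mono)
    with buildOmegaSequence (Vec.tail ∘ G) sequence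
  ... | _ , C₁ , weight₁≡ , c₁ with addMonotoneOver C₁ c₁ a-mono
  ... | N₂ , C₂ , weight₂≡ , c₂ , c₂a =
    _ , C₂ ▷ g , cong suc (trans weight₂≡ weight₁≡) ,
    computesAll-≗ (λ x → cong (_++ x) (head∷tail (G x)))
      (computesAll-∷ (computes-≗ ωa≗g (gate-computes c₂a (nonmono i))) (computesAll-▷ g c₂))
    where
    g : Gate B N₂
    g = gate (arity B i) (nonmono i) (nodes c₂a)

  profile⇒circuit : ∀ {w} → Profile w →
                    ∃ λ N → Σ (Circuit B n N) λ C → Realizes C F × weight C ≡ w
  profile⇒circuit (G , sequence , outputs-mono) with buildOmegaSequence G sequence
  ... | _ , C₁ , weight₁≡ , c₁ with addMonotoneOver C₁ c₁ outputs-mono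
  ... | _ , C₂ , weight₂≡ , _ , c₂ = _ , C₂ , realizes , trans weight₂≡ weight₁≡
    where
    realizes : Realizes C₂ F
    realizes j = let node o correct = computes c₂ j in
      o , λ x → trans (correct x) (Vecₚ.lookup∘tabulate (λ l → lookup F l x) j)

-- Markov's construction

isOdd : ℕ → Bool
isOdd zero = false
isOdd (suc zero) = true
isOdd (suc (suc k)) = isOdd k

isOdd+2*⌊/2⌋ : ∀ k → bitValue (isOdd k) + 2 * ⌊ k /2⌋ ≡ k
isOdd+2*⌊/2⌋ zero = refl
isOdd+2*⌊/2⌋ (suc zero) = refl
isOdd+2*⌊/2⌋ (suc (suc k)) = begin
  bitValue (isOdd k) + 2 * suc ⌊ k /2⌋   ≡⟨ cong (bitValue (isOdd k) +_) (*-suc 2 ⌊ k /2⌋) ⟩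
  bitValue (isOdd k) + (2 + 2 * ⌊ k /2⌋) ≡⟨ +-assoc (bitValue (isOdd k)) 2 _ ⟨
  bitValue (isOdd k) + 2 + 2 * ⌊ k /2⌋   ≡⟨ cong (_+ 2 * ⌊ k /2⌋) (+-comm (bitValue (isOdd k)) 2) ⟩
  2 + bitValue (isOdd k) + 2 * ⌊ k /2⌋   ≡⟨ cong (2 +_) (isOdd+2*⌊/2⌋ k) ⟩
  2 + k                                   ∎
  where open ≡-Reasoning

⌊/2⌋<2^ : ∀ s k → k < 2 ^ suc s → ⌊ k /2⌋ < 2 ^ s
⌊/2⌋<2^ s k k<2^1+s = *-cancelˡ-< 2 ⌊ k /2⌋ (2 ^ s) (begin-strict
  2 * ⌊ k /2⌋                       ≤⟨ m≤n+m (2 * ⌊ k /2⌋) (bitValue (isOdd k)) ⟩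
  bitValue (isOdd k) + 2 * ⌊ k /2⌋  ≡⟨ isOdd+2*⌊/2⌋ k ⟩
  k                                 <⟨ k<2^1+s ⟩
  2 * 2 ^ s                         ∎)
  where open ≤-Reasoning

bitValue-reflects-≤ : ∀ a b → bitValue a ≤ bitValue b → a Bool.≤ b
bitValue-reflects-≤ false b _ = Boolₚ.≤-minimum b
bitValue-reflects-≤ true true _ = b≤b
bitValue-reflects-≤ true false ()

isOdd-mono-on-⌊/2⌋ : ∀ {k l} → ⌊ k /2⌋ ≡ ⌊ l /2⌋ → k ≤ l → isOdd k Bool.≤ isOdd l
isOdd-mono-on-⌊/2⌋ {k} {l} halves≡ k≤l =
  bitValue-reflects-≤ _ _ (+-cancelʳ-≤ (2 * ⌊ l /2⌋) _ _ (begin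
  bitValue (isOdd k) + 2 * ⌊ l /2⌋   ≡⟨ cong (λ h → bitValue (isOdd k) + 2 * h) halves≡ ⟨
  bitValue (isOdd k) + 2 * ⌊ k /2⌋   ≡⟨ isOdd+2*⌊/2⌋ k ⟩
  k                                  ≤⟨ k≤l ⟩
  l                                  ≡⟨ isOdd+2*⌊/2⌋ l ⟨
  bitValue (isOdd l) + 2 * ⌊ l /2⌋   ∎))
  where open ≤-Reasoning

-- The binary digits of k, least significant first and complemented, so that
-- the componentwise order reverses the order of numbers.
coBits : ∀ s → ℕ → Vec Bool s
coBits zero k = []
coBits (suc s) k = not (isOdd k) ∷ coBits s ⌊ k /2⌋

coBitsValue : ∀ {s} → Vec Bool s → ℕ
coBitsValue [] = 0
coBitsValue (c ∷ cs) = bitValue (not c) + 2 * coBitsValue cs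

coBitsValue-coBits : ∀ s k → k < 2 ^ s → coBitsValue (coBits s k) ≡ k
coBitsValue-coBits zero zero _ = refl
coBitsValue-coBits zero (suc k) (s≤s ())
coBitsValue-coBits (suc s) k k<2^1+s = begin
  bitValue (not (not (isOdd k))) + 2 * coBitsValue (coBits s ⌊ k /2⌋)
    ≡⟨ cong₂ (λ b h → bitValue b + 2 * h) (Boolₚ.not-involutive (isOdd k))
             (coBitsValue-coBits s ⌊ k /2⌋ (⌊/2⌋<2^ s k k<2^1+s)) ⟩
  bitValue (isOdd k) + 2 * ⌊ k /2⌋
    ≡⟨ isOdd+2*⌊/2⌋ k ⟩
  k ∎
  where open ≡-Reasoning

coBitsValue-antitone : ∀ {s} {c c′ : Vec Bool s} → c ≼ c′ → coBitsValue c′ ≤ coBitsValue c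
coBitsValue-antitone [] = z≤n
coBitsValue-antitone {c = _ ∷ cs} {_ ∷ cs′} (f≤t ∷ cs≼cs′) =
  +-mono-≤ {0} {1} z≤n (*-monoʳ-≤ 2 (coBitsValue-antitone cs≼cs′))
coBitsValue-antitone {c = b ∷ _} (b≤b ∷ cs≼cs′) =
  +-monoʳ-≤ (bitValue (not b)) (*-monoʳ-≤ 2 (coBitsValue-antitone cs≼cs′))

coBits-antitone⁻ : ∀ s {k l} → k < 2 ^ s → l < 2 ^ s → coBits s k ≼ coBits s l → l ≤ k
coBits-antitone⁻ s {k} {l} k< l< bits≼ =
  subst₂ _≤_ (coBitsValue-coBits s l l<) (coBitsValue-coBits s k k<) (coBitsValue-antitone bits≼)

module Markov (B : Basis) {n m : ℕ} (F : Vec (BF n) m) where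
  open Profiles B F

  private
    i₀ : Fin (p B)
    i₀ = Fin.fromℕ< (p≥1 B)

    negation : Σ (Bool → Vec Bool (arity B i₀)) λ s →
               s Preserves Bool._≤_ ⟶ _≼_ × (∀ b → ω B i₀ (s b) ≡ not b)
    negation = nonMonotone⇒negation (ω B i₀) (ω-nonmono B i₀)

    segment : Bool → Vec Bool (arity B i₀)
    segment = proj₁ negation

  -- The lowest digit is not (isOdd μ), i.e. ω applied to the monotone segment at
  -- isOdd μ, and isOdd μ is monotone wherever the higher digits agree.
  coBits-sequence : ∀ s (μ : Vec Bool n → ℕ) → μ Preserves _≼_ ⟶ _≤_ → (∀ x → μ x < 2 ^ s) →
                    OmegaSequence (coBits s ∘ μ)
  coBits-sequence zero μ _ _ = tt
  coBits-sequence (suc s) μ μ-mono μ< =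
    coBits-sequence s half (⌊n/2⌋-mono ∘ μ-mono) half< ,
    i₀ , segment ∘ isOdd ∘ μ , proj₂ (proj₂ negation) ∘ isOdd ∘ μ , parity-mono
    where
    half : Vec Bool n → ℕ
    half x = ⌊ μ x /2⌋
    half< : ∀ x → half x < 2 ^ s
    half< x = ⌊/2⌋<2^ s (μ x) (μ< x)
    parity-mono : MonotoneOver (withInputs (coBits s ∘ half)) (segment ∘ isOdd ∘ μ)
    parity-mono {x} {y} le =
      let bits≼ , x≼y = Pointwise.++⁻ (coBits s (half x)) (coBits s (half y)) le
          halves≡ = ≤-antisym (⌊n/2⌋-mono (μ-mono x≼y))
                              (coBits-antitone⁻ s (half< x) (half< y) bits≼)
      in proj₁ (proj₂ negation) (isOdd-mono-on-⌊/2⌋ halves≡ (μ-mono x≼y))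

  markovProfile : ∀ {d} → JumpRank F d → Profile ⌈log₂ (d + 1) ⌉
  markovProfile {d} jumpRank = coBits U ∘ rank , coBits-sequence U rank rank-mono rank< , outputs-mono
    where
    open JumpRank jumpRank
    U : ℕ
    U = ⌈log₂ (d + 1) ⌉
    rank< : ∀ x → rank x < 2 ^ U
    rank< x = ≤-<-trans (rank-bound x) (subst (_≤ 2 ^ U) (+-comm d 1) (n≤2^⌈log₂n⌉ (d + 1)))
    outputs-mono : MonotoneOver (withInputs (coBits U ∘ rank)) outputs
    outputs-mono {x} {y} le =
      let bits≼ , x≼y = Pointwise.++⁻ (coBits U (rank x)) (coBits U (rank y)) le in
      Pointwise.tabulate⁺ λ j → ≤-noDrop _ _ λ Fx Fy →
        <⇒≱ (rank-jump (x≼y , j , Fx , Fy)) (coBits-antitone⁻ U (rank< x) (rank< y) bits≼)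

Least : (ℕ → Set) → ℕ → Set
Least P i = P i × (∀ j → P j → i ≤ j)

leastBelow : {P : ℕ → Set} → Decidable P → ∀ k → ∃ (Least P) ⊎ (∀ j → j < k → ¬ P j)
leastBelow P? zero = inj₂ λ _ ()
leastBelow P? (suc k) with leastBelow P? k | P? k
... | inj₁ least | _ = inj₁ least
... | inj₂ none | yes Pk = inj₁ (k , Pk , λ j Pj → ≮⇒≥ λ j<k → none j j<k Pj)
... | inj₂ none | no ¬Pk = inj₂ λ j j<1+k →
  [ (λ j<k → none j j<k) , (λ { refl → ¬Pk }) ]′ (m<1+n⇒m<n∨m≡n j<1+k)

least : {P : ℕ → Set} → Decidable P → ∀ {u} → P u → ∃ (Least P)
least P? {u} Pu = [ id , (λ none → ⊥-elim (none u (n<1+n u) Pu)) ]′ (leastBelow P? (suc u))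

mainTheorem1 : (B : Basis) → Σ ℕ λ c →
  ∀ (n m : ℕ) (F : Vec (BF n) m) (d : ℕ) → IsDecrease F d →
    Σ ℕ λ I → IsInversionComplexity B F I
      × ⌈log₂ (d + 1) ⌉ ≤ I + c
      × I ≤ ⌈log₂ (d + 1) ⌉
mainTheorem1 B = c , λ n m F d isDecrease →
  let open Profiles B F
      markov = Markov.markovProfile B F (Climb.jumpRank F isDecrease)
      I , profileI , I-least = least profile? markov
      N , C , R , weight≡I = profile⇒circuit profileI
  in I , ((N , C , R , weight≡I) , λ N′ C′ R′ → I-least (weight C′) (circuit⇒profile C′ R′)) ,
     subst (λ w → ⌈log₂ (d + 1) ⌉ ≤ w + c) weight≡I (Potential.lowerBound C R isDecrease) ,
     I-least ⌈log₂ (d + 1) ⌉ markov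
  where
  c : ℕ
  c = ⌈log₂ arityBound B ⌉
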